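{- Let $n\in\mathbb{N}$ be even, and define Boolean functions in the variables $x_1,\ldots,x_n$ by $$f_1(x_1,\ldots,x_n) := \Big(\bigwedge_{i=1}^{n/2} x_i\Big)\lor \Big(\bigwedge_{i=1}^{n} \neg x_i\Big),\qquad f_2(x_1,\ldots,x_n) := \Big(\bigwedge_{i=n/2+1}^{n} x_i\Big)\lor \Big(\bigwedge_{i=1}^{n} \neg x_i\Big).$$ Then there is a switch-list representation of $f_1$ with at most two switches, and there is a switch-list representation of $f_2$ with at most two switches.
   Context: Let $f$ be a Boolean function in the variables $x_1,\ldots,x_n$ and let $\pi$ be a permutation of $\{1,\ldots,n\}$ (a variable order). An assignment $a:\{x_1,\ldots,x_n\}\to\{0,1\}$ is identified with the number $b(a)=\sum_{i=1}^n a(x_{\pi(i)})2^{i-1}\in\{0,\ldots,2^n-1\}$; via this identification $f$ is viewed as a function on $\{0,\ldots,2^n-1\}$. A switch of $f$ with respect to $\pi$ is a number $b\in\{1,\ldots,2^n-1\}$ with $f(b)\neq f(b-1)$. The switch-list representation of $f$ with respect to $\pi$ consists of the value $f(0)$ together with the ordered list of all switches of $f$ with respect to $\pi$. A switch-list representation of $f$ means a switch-list representation with respect to some order $\pi$. -}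

module Defs where

open import Data.Nat using (ℕ; zero; suc; _+_; _*_; _^_; _∸_; _<_; _≤_; _≤ᵇ_; _<ᵇ_)
open import Data.Nat.DivMod using (_/_; _%_)
open import Data.Nat.Properties using (_≟_)
open import Data.Bool using (Bool; true; false; _∧_; _∨_; not; if_then_else_)
open import Data.Bool.Properties renaming (_≟_ to _≟ᵇ_)
open import Data.Fin using (Fin; toℕ) renaming (zero to fzero; suc to fsuc)
open import Data.Fin.Permutation using (Permutation′; _⟨$⟩ʳ_; _⟨$⟩ˡ_)
open import Data.List using (List; []; _∷_; filter; length; map)
open import Data.List.Base using (upTo)
open import Relation.Nullary using (¬?)
open import Data.Product using (Σ; _×_; _,_; proj₂)

-- A Boolean function in the variables x_1,…,x_n: variable x_{i+1} is index i : Fin n.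
BoolFun : ℕ → Set
BoolFun n = (Fin n → Bool) → Bool

bit : ℕ → ℕ → Bool
bit b zero = 1 ≤ᵇ (b % 2)
bit b (suc k) = bit (b / 2) k

-- The assignment identified with number b under order π:
-- b = Σ_{i=1}^n a(x_{π(i)}) 2^{i-1}, i.e. a(x_{π(i)}) = bit (i-1) of b,
-- i.e. a(x_j) = bit (π⁻¹ j) of b.  (π : Fin n → Fin n, 0-based.)
assignment : {n : ℕ} → Permutation′ n → ℕ → (Fin n → Bool)
assignment π b j = bit b (toℕ (π ⟨$⟩ˡ j))

fNum : {n : ℕ} → BoolFun n → Permutation′ n → ℕ → Bool
fNum f π b = f (assignment π b)

switches : {n : ℕ} → BoolFun n → Permutation′ n → List ℕ
switches {n} f π =
  filter (λ b → ¬? (fNum f π b ≟ᵇ fNum f π (b ∸ 1))) (map suc (upTo (2 ^ n ∸ 1)))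

switchList : {n : ℕ} → BoolFun n → Permutation′ n → Bool × List ℕ
switchList f π = (fNum f π 0 , switches f π)

HasSwitchListWithAtMost : {n : ℕ} → ℕ → BoolFun n → Set
HasSwitchListWithAtMost {n} k f =
  Σ (Permutation′ n) λ π → length (proj₂ (switchList f π)) ≤ k

allFin : (n : ℕ) → (Fin n → Bool) → Bool
allFin zero p = true
allFin (suc n) p = p fzero ∧ allFin n (λ i → p (fsuc i))

f₁ : (m : ℕ) → BoolFun (m + m)
f₁ m a = allFin (m + m) (λ i → if toℕ i <ᵇ m then a i else true)
       ∨ allFin (m + m) (λ i → not (a i))

f₂ : (m : ℕ) → BoolFun (m + m)
f₂ m a = allFin (m + m) (λ i → if m ≤ᵇ toℕ i then a i else true)
       ∨ allFin (m + m) (λ i → not (a i))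

module Submission where

-- In the natural order the variables x_{m+1},…,x_n are the m high bits of the number b,
-- so f₂ read as a function on numbers is true exactly at b = 0 and at b ≥ 2^n − 2^m: its
-- switches lie among 1 and 2^n − 2^m.  Reading the variables in the reversed order turns
-- x_1,…,x_m into the high bits, and f₁ read in the reversed order is literally the same
-- function on numbers as f₂ read in the natural order.

open import Defs
open import Data.Bool using (Bool; true; false; _∨_; not; if_then_else_)
open import Data.Bool.Properties using (⇔→≡; not-injective) renaming (_≟_ to _≟ᵇ_)
open import Data.Empty using (⊥-elim)
open import Data.Fin using (Fin; toℕ; fromℕ<; opposite) renaming (zero to fzero; suc to fsuc)
open import Data.Fin.Permutation using (Permutation′; _⟨$⟩ʳ_; _⟨$⟩ˡ_; inverseʳ)
import Data.Fin.Permutation as Perm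
open import Data.Fin.Properties using (toℕ<n; toℕ-fromℕ<; opposite-prop; opposite-involutive)
open import Data.List using (List; []; _∷_; length; map; upTo)
open import Data.List.Relation.Unary.All as All using (All; _∷_)
import Data.List.Relation.Unary.All.Properties as All
open import Data.List.Relation.Unary.AllPairs using (_∷_)
open import Data.List.Relation.Unary.Unique.Propositional using (Unique)
import Data.List.Relation.Unary.Unique.Propositional.Properties as Unique
open import Data.Nat using (ℕ; zero; suc; pred; _+_; _*_; _^_; _∸_; _≤_; _<_; _≤ᵇ_; _<ᵇ_; _≡ᵇ_; z≤n; s≤s; s≤s⁻¹; NonZero)
open import Data.Nat.Divisibility using (divides-refl)
open import Data.Nat.DivMod
open import Data.Nat.Properties
open import Data.Product using (_×_; _,_)
open import Data.Product.Function.NonDependent.Propositional using (_×-⇔_)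
open import Data.Sum using (_⊎_; inj₁; inj₂)
open import Function using (id; _∘_; _⇔_; mk⇔; Equivalence)
open import Function.Properties.Equivalence using (⇔-setoid)
open import Level using (0ℓ)
open import Relation.Binary.PropositionalEquality
import Relation.Binary.Reasoning.Setoid
open import Relation.Nullary.Decidable using (proof; ¬?)
open import Relation.Nullary.Reflects using (Reflects; ofʸ; ofⁿ)
open import Relation.Unary using (Decidable)

Reflects⇒≡true⇔ : ∀ {P : Set} {b} → Reflects P b → b ≡ true ⇔ P
Reflects⇒≡true⇔ (ofʸ p) = mk⇔ (λ _ → p) (λ _ → refl)
Reflects⇒≡true⇔ (ofⁿ ¬p) = mk⇔ (λ ()) (⊥-elim ∘ ¬p)

guarded⇔ : ∀ {c x : Bool} → (if c then x else true) ≡ true ⇔ (c ≡ true → x ≡ true)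
guarded⇔ {true}  = mk⇔ (λ h _ → h) (λ h → h refl)
guarded⇔ {false} = mk⇔ (λ _ ()) (λ _ → refl)

∀<suc⇔ : ∀ n (P : ℕ → Set) → (∀ k → k < suc n → P k) ⇔ (P 0 × ∀ k → k < n → P (suc k))
∀<suc⇔ n P = mk⇔ (λ h → h 0 (s≤s z≤n) , λ k k<n → h (suc k) (s≤s k<n))
                 λ { (P0 , h) zero _ → P0 ; (P0 , h) (suc k) (s≤s k<n) → h k k<n }

module ⇔-Reasoning = Relation.Binary.Reasoning.Setoid (⇔-setoid 0ℓ)

allFin⇔ : ∀ n (p : Fin n → Bool) → allFin n p ≡ true ⇔ (∀ i → p i ≡ true)
allFin⇔ n p = mk⇔ (to n p) (from n p)
  where
  to : ∀ n (p : Fin n → Bool) → allFin n p ≡ true → ∀ i → p i ≡ true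
  to (suc n) p h i with p fzero in p0
  to (suc n) p h fzero    | true = p0
  to (suc n) p h (fsuc i) | true = to n (p ∘ fsuc) h i
  from : ∀ n (p : Fin n → Bool) → (∀ i → p i ≡ true) → allFin n p ≡ true
  from zero    p h = refl
  from (suc n) p h rewrite h fzero = from n (p ∘ fsuc) (h ∘ fsuc)

allFin-permute : ∀ {n} (σ : Permutation′ n) {p q : Fin n → Bool} →
                 (∀ i → p (σ ⟨$⟩ʳ i) ≡ q i) → allFin n p ≡ allFin n q
allFin-permute {n} σ {p} {q} p∘σ≗q = ⇔→≡ (mk⇔
  (λ all-p → from (allFin⇔ n q) λ i → trans (sym (p∘σ≗q i)) (to (allFin⇔ n p) all-p (σ ⟨$⟩ʳ i)))
  (λ all-q → from (allFin⇔ n p) λ i → trans (cong p (sym (inverseʳ σ)))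
                                         (trans (p∘σ≗q (σ ⟨$⟩ˡ i)) (to (allFin⇔ n q) all-q (σ ⟨$⟩ˡ i)))))
  where open Equivalence

allFin-from⇔ : ∀ m n (p : ℕ → Bool) →
               allFin (m + n) (λ i → if m ≤ᵇ toℕ i then p (toℕ i) else true) ≡ true ⇔
               (∀ k → k < n → p (m + k) ≡ true)
allFin-from⇔ m n p = mk⇔ to′ from′
  where
  open Equivalence
  ≤ᵇ⇔ : ∀ {t} → (m ≤ᵇ t) ≡ true ⇔ m ≤ t
  ≤ᵇ⇔ {t} = Reflects⇒≡true⇔ (≤ᵇ-reflects-≤ m t)

  to′ : allFin (m + n) (λ i → if m ≤ᵇ toℕ i then p (toℕ i) else true) ≡ true →
        ∀ k → k < n → p (m + k) ≡ true
  to′ h k k<n = subst (λ t → p t ≡ true) (toℕ-fromℕ< m+k<) (to guarded⇔ (to (allFin⇔ _ _) h i) m≤i)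
    where
    m+k< = +-monoʳ-< m k<n
    i = fromℕ< m+k<
    m≤i = from ≤ᵇ⇔ (subst (m ≤_) (sym (toℕ-fromℕ< m+k<)) (m≤m+n m k))

  from′ : (∀ k → k < n → p (m + k) ≡ true) →
          allFin (m + n) (λ i → if m ≤ᵇ toℕ i then p (toℕ i) else true) ≡ true
  from′ h = from (allFin⇔ _ _) λ i → from guarded⇔ λ m≤ᵇi →
    let m+[i∸m]≡i = m+[n∸m]≡n (to ≤ᵇ⇔ m≤ᵇi)
        i∸m<n = +-cancelˡ-< m _ _ (subst (_< m + n) (sym m+[i∸m]≡i) (toℕ<n i))
    in subst (λ t → p t ≡ true) m+[i∸m]≡i (h (toℕ i ∸ m) i∸m<n)

bit-shift : ∀ k j y .{{_ : NonZero (2 ^ k)}} → bit y (k + j) ≡ bit (y / 2 ^ k) j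
bit-shift zero    j y = cong (λ z → bit z j) (sym (n/1≡n y))
bit-shift (suc k) j y =
  trans (bit-shift k j (y / 2) {{2^k≢0}}) (cong (λ z → bit z j) (m/n/o≡m/[n*o] y 2 (2 ^ k) {{_}} {{2^k≢0}}))
  where
  2^k≢0 : NonZero (2 ^ k)
  2^k≢0 = m^n≢0 2 k

bit0≡true⇔ : ∀ y → bit y 0 ≡ true ⇔ y % 2 ≡ 1
bit0≡true⇔ y with y % 2 | m%n<n y 2
... | 0 | _ = mk⇔ (λ ()) (λ ())
... | 1 | _ = mk⇔ (λ _ → refl) (λ _ → refl)
... | suc (suc _) | s≤s (s≤s ())

bit0≡false⇔ : ∀ y → bit y 0 ≡ false ⇔ y % 2 ≡ 0
bit0≡false⇔ y with y % 2 | m%n<n y 2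
... | 0 | _ = mk⇔ (λ _ → refl) (λ _ → refl)
... | 1 | _ = mk⇔ (λ ()) (λ ())
... | suc (suc _) | s≤s (s≤s ())

odd-halves : ∀ {y c} → suc y ≡ c * 2 → y % 2 ≡ 1 × suc (y / 2) ≡ c
odd-halves {c = suc c} refl =
  [m+kn]%n≡m%n 1 c 2 , cong suc (trans (+-distrib-/-∣ʳ 1 {d = 2} (divides-refl c)) (m*n/n≡m c 2))

suc≡*2⇔ : ∀ y c → suc y ≡ c * 2 ⇔ (y % 2 ≡ 1 × suc (y / 2) ≡ c)
suc≡*2⇔ y c = mk⇔ odd-halves λ (y%2≡1 , e) → begin
  suc y                   ≡⟨ cong suc (m≡m%n+[m/n]*n y 2) ⟩
  suc (y % 2 + y / 2 * 2) ≡⟨ cong (λ r → suc (r + y / 2 * 2)) y%2≡1 ⟩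
  suc (y / 2) * 2         ≡⟨ cong (_* 2) e ⟩
  c * 2                   ∎
  where open ≡-Reasoning

/2-< : ∀ n {y} → y < 2 ^ suc n → y / 2 < 2 ^ n
/2-< n {y} y<2^[1+n] = m<n*o⇒m/o<n (subst (y <_) (*-comm 2 (2 ^ n)) y<2^[1+n])

bits-allOne⇔ : ∀ n {y} → y < 2 ^ n → (∀ k → k < n → bit y k ≡ true) ⇔ suc y ≡ 2 ^ n
bits-allOne⇔ zero    {zero} _ = mk⇔ (λ _ → refl) (λ _ _ ())
bits-allOne⇔ zero    {suc y} (s≤s ())
bits-allOne⇔ (suc n) {y} y<2^[1+n] = begin
  (∀ k → k < suc n → bit y k ≡ true)                    ≈⟨ ∀<suc⇔ n _ ⟩
  (bit y 0 ≡ true × (∀ k → k < n → bit (y / 2) k ≡ true)) ≈⟨ bit0≡true⇔ y ×-⇔ bits-allOne⇔ n (/2-< n y<2^[1+n]) ⟩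
  (y % 2 ≡ 1 × suc (y / 2) ≡ 2 ^ n)                     ≈⟨ suc≡*2⇔ y (2 ^ n) ⟨
  suc y ≡ 2 ^ n * 2                                     ≡⟨ cong (suc y ≡_) (*-comm (2 ^ n) 2) ⟩
  suc y ≡ 2 ^ suc n                                     ∎
  where open ⇔-Reasoning

y≡0⇔ : ∀ y → y ≡ 0 ⇔ (y % 2 ≡ 0 × y / 2 ≡ 0)
y≡0⇔ y = mk⇔ (λ { refl → refl , refl })
  λ (y%2≡0 , y/2≡0) → trans (m≡m%n+[m/n]*n y 2) (cong₂ (λ r q → r + q * 2) y%2≡0 y/2≡0)

bits-allZero⇔ : ∀ n {y} → y < 2 ^ n → (∀ k → k < n → bit y k ≡ false) ⇔ y ≡ 0
bits-allZero⇔ zero    {zero} _ = mk⇔ (λ _ → refl) (λ _ _ ())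
bits-allZero⇔ zero    {suc y} (s≤s ())
bits-allZero⇔ (suc n) {y} y<2^[1+n] = begin
  (∀ k → k < suc n → bit y k ≡ false)                     ≈⟨ ∀<suc⇔ n _ ⟩
  (bit y 0 ≡ false × (∀ k → k < n → bit (y / 2) k ≡ false)) ≈⟨ bit0≡false⇔ y ×-⇔ bits-allZero⇔ n (/2-< n y<2^[1+n]) ⟩
  (y % 2 ≡ 0 × y / 2 ≡ 0)                                 ≈⟨ y≡0⇔ y ⟨
  y ≡ 0                                                   ∎
  where open ⇔-Reasoning

m/n≡o⇔o*n≤m : ∀ {m n o} .{{_ : NonZero n}} → m < suc o * n → m / n ≡ o ⇔ o * n ≤ m
m/n≡o⇔o*n≤m {m} {n} {o} m<[1+o]*n = mk⇔
  (λ m/n≡o → subst (λ q → q * n ≤ m) m/n≡o (m/n*n≤m m n))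
  (λ o*n≤m → ≤-antisym (s≤s⁻¹ (m<n*o⇒m/o<n m<[1+o]*n))
                       (subst (_≤ m / n) (m*n/n≡m o n) (/-monoˡ-≤ n o*n≤m)))

≡∨≡-pigeonhole : ∀ {A : Set} {s t x y z : A} →
                 x ≡ s ⊎ x ≡ t → y ≡ s ⊎ y ≡ t → z ≡ s ⊎ z ≡ t → x ≡ y ⊎ x ≡ z ⊎ y ≡ z
≡∨≡-pigeonhole (inj₁ p) (inj₁ q) _        = inj₁ (trans p (sym q))
≡∨≡-pigeonhole (inj₂ p) (inj₂ q) _        = inj₁ (trans p (sym q))
≡∨≡-pigeonhole (inj₁ p) (inj₂ _) (inj₁ r) = inj₂ (inj₁ (trans p (sym r)))
≡∨≡-pigeonhole (inj₂ p) (inj₁ _) (inj₂ r) = inj₂ (inj₁ (trans p (sym r)))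
≡∨≡-pigeonhole (inj₁ _) (inj₂ q) (inj₂ r) = inj₂ (inj₂ (trans q (sym r)))
≡∨≡-pigeonhole (inj₂ _) (inj₁ q) (inj₁ r) = inj₂ (inj₂ (trans q (sym r)))

Unique∧All≡∨≡⇒length≤2 : ∀ {A : Set} {s t : A} {xs : List A} →
                          Unique xs → All (λ x → x ≡ s ⊎ x ≡ t) xs → length xs ≤ 2
Unique∧All≡∨≡⇒length≤2 {xs = []}         _ _ = z≤n
Unique∧All≡∨≡⇒length≤2 {xs = _ ∷ []}     _ _ = s≤s z≤n
Unique∧All≡∨≡⇒length≤2 {xs = _ ∷ _ ∷ []} _ _ = s≤s (s≤s z≤n)
Unique∧All≡∨≡⇒length≤2 {xs = _ ∷ _ ∷ _ ∷ _} ((x≢y ∷ x≢z ∷ _) ∷ (y≢z ∷ _) ∷ _) (x∈ ∷ y∈ ∷ z∈ ∷ _)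
  with ≡∨≡-pigeonhole x∈ y∈ z∈
... | inj₁ x≡y        = ⊥-elim (x≢y x≡y)
... | inj₂ (inj₁ x≡z) = ⊥-elim (x≢z x≡z)
... | inj₂ (inj₂ y≡z) = ⊥-elim (y≢z y≡z)

<∸1⇒suc< : ∀ {i N} → i < N ∸ 1 → suc i < N
<∸1⇒suc< {N = suc N} i<N = s≤s i<N

length-switches≤2 : ∀ {n} (f : BoolFun n) (π : Permutation′ n) {s t} →
  (∀ b → suc b < 2 ^ n → fNum f π (suc b) ≢ fNum f π b → suc b ≡ s ⊎ suc b ≡ t) →
  length (switches f π) ≤ 2
length-switches≤2 {n} f π {s} {t} located = Unique∧All≡∨≡⇒length≤2
  (Unique.filter⁺ isSwitch? (Unique.map⁺ suc-injective (Unique.upTo⁺ (2 ^ n ∸ 1))))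
  (All.zipWith (λ (located-b , switch-b) → located-b switch-b)
    (All.filter⁺ isSwitch? located-candidates , All.all-filter isSwitch? candidates))
  where
  isSwitch? : Decidable (λ b → fNum f π b ≢ fNum f π (b ∸ 1))
  isSwitch? b = ¬? (fNum f π b ≟ᵇ fNum f π (b ∸ 1))
  candidates : List ℕ
  candidates = map suc (upTo (2 ^ n ∸ 1))
  located-candidates : All (λ b → fNum f π b ≢ fNum f π (b ∸ 1) → b ≡ s ⊎ b ≡ t) candidates
  located-candidates = All.map⁺ (All.applyUpTo⁺₁ id (2 ^ n ∸ 1) λ i< → located _ (<∸1⇒suc< i<))

≤ᵇ-switch : ∀ K b → (K ≤ᵇ suc b) ≢ (K ≤ᵇ b) → suc b ≡ K
≤ᵇ-switch K b ne with K ≤ᵇ suc b | ≤ᵇ-reflects-≤ K (suc b) | K ≤ᵇ b | ≤ᵇ-reflects-≤ K b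
... | true  | ofʸ K≤1+b | false | ofⁿ K≰b = ≤-antisym (≰⇒> K≰b) K≤1+b
... | false | ofⁿ K≰1+b | true  | ofʸ K≤b = ⊥-elim (K≰1+b (m≤n⇒m≤1+n K≤b))
... | true  | _ | true  | _ = ⊥-elim (ne refl)
... | false | _ | false | _ = ⊥-elim (ne refl)

≤ᵇ∨≡ᵇ0-switch : ∀ K b → ((K ≤ᵇ suc b) ∨ (suc b ≡ᵇ 0)) ≢ ((K ≤ᵇ b) ∨ (b ≡ᵇ 0)) → suc b ≡ 1 ⊎ suc b ≡ K
≤ᵇ∨≡ᵇ0-switch K zero    _  = inj₁ refl
≤ᵇ∨≡ᵇ0-switch K (suc b) ne = inj₂ (≤ᵇ-switch K (suc b) (ne ∘ cong (_∨ false)))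

-- 2^{2m} − 2^m: the least 2m-bit number whose upper m bits are all set.
f₂-threshold : ℕ → ℕ
f₂-threshold m = pred (2 ^ m) * 2 ^ m

allFin-upperBits≡f₂-threshold≤ᵇ : ∀ m {b} → b < 2 ^ (m + m) →
  allFin (m + m) (λ i → if m ≤ᵇ toℕ i then bit b (toℕ i) else true) ≡ (f₂-threshold m ≤ᵇ b)
allFin-upperBits≡f₂-threshold≤ᵇ m {b} b<2^[m+m] = ⇔→≡ (begin
  allFin (m + m) (λ i → if m ≤ᵇ toℕ i then bit b (toℕ i) else true) ≡ true
    ≈⟨ allFin-from⇔ m m (bit b) ⟩
  (∀ k → k < m → bit b (m + k) ≡ true)
    ≈⟨ mk⇔ (λ h k k<m → trans (sym (bit-shift m k b)) (h k k<m))
           (λ h k k<m → trans (bit-shift m k b) (h k k<m)) ⟩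
  (∀ k → k < m → bit (b / 2 ^ m) k ≡ true)
    ≈⟨ bits-allOne⇔ m (m<n*o⇒m/o<n b<2^m*2^m) ⟩
  suc (b / 2 ^ m) ≡ 2 ^ m
    ≈⟨ mk⇔ (cong pred) (λ e → trans (cong suc e) (suc-pred (2 ^ m))) ⟩
  b / 2 ^ m ≡ pred (2 ^ m)
    ≈⟨ m/n≡o⇔o*n≤m (subst (λ p → b < p * 2 ^ m) (sym (suc-pred (2 ^ m))) b<2^m*2^m) ⟩
  f₂-threshold m ≤ b
    ≈⟨ Reflects⇒≡true⇔ (≤ᵇ-reflects-≤ _ b) ⟨
  (f₂-threshold m ≤ᵇ b) ≡ true
    ∎)
  where
  open ⇔-Reasoning
  instance
    2^m≢0 : NonZero (2 ^ m)
    2^m≢0 = m^n≢0 2 m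
  b<2^m*2^m : b < 2 ^ m * 2 ^ m
  b<2^m*2^m = subst (b <_) (^-distribˡ-+-* 2 m m) b<2^[m+m]

allFin-noBit≡[≡ᵇ0] : ∀ n {b} → b < 2 ^ n → allFin n (λ i → not (bit b (toℕ i))) ≡ (b ≡ᵇ 0)
allFin-noBit≡[≡ᵇ0] n {b} b<2^n = ⇔→≡ (begin
  allFin n (λ i → not (bit b (toℕ i))) ≡ true ≈⟨ allFin-from⇔ 0 n (not ∘ bit b) ⟩
  (∀ k → k < n → not (bit b k) ≡ true)        ≈⟨ mk⇔ (λ h k k<n → not-injective (h k k<n))
                                                      (λ h k k<n → cong not (h k k<n)) ⟩
  (∀ k → k < n → bit b k ≡ false)             ≈⟨ bits-allZero⇔ n b<2^n ⟩
  b ≡ 0                                       ≈⟨ Reflects⇒≡true⇔ (proof (b ≟ 0)) ⟨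
  (b ≡ᵇ 0) ≡ true                             ∎)
  where open ⇔-Reasoning

fNum-f₂ : ∀ m {b} → b < 2 ^ (m + m) → fNum (f₂ m) Perm.id b ≡ (f₂-threshold m ≤ᵇ b) ∨ (b ≡ᵇ 0)
fNum-f₂ m b<2^[m+m] =
  cong₂ _∨_ (allFin-upperBits≡f₂-threshold≤ᵇ m b<2^[m+m]) (allFin-noBit≡[≡ᵇ0] (m + m) b<2^[m+m])

fNum-f₂-switch : ∀ m b → suc b < 2 ^ (m + m) →
                 fNum (f₂ m) Perm.id (suc b) ≢ fNum (f₂ m) Perm.id b → suc b ≡ 1 ⊎ suc b ≡ f₂-threshold m
fNum-f₂-switch m b 1+b< =
  ≤ᵇ∨≡ᵇ0-switch _ b ∘ subst₂ _≢_ (fNum-f₂ m 1+b<) (fNum-f₂ m (<-trans (n<1+n b) 1+b<))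

a+suc[t]≡m+m⇒a<m⇔m≤t : ∀ {a t m} → a + suc t ≡ m + m → a < m ⇔ m ≤ t
a+suc[t]≡m+m⇒a<m⇔m≤t {a} {t} {m} e = mk⇔
  (λ a<m → +-cancelˡ-≤ m m t (subst (_≤ m + t) e′ (+-monoˡ-≤ t a<m)))
  (λ m≤t → +-cancelʳ-≤ m (suc a) m (subst (suc a + m ≤_) e′ (+-monoʳ-≤ (suc a) m≤t)))
  where
  e′ : suc a + t ≡ m + m
  e′ = trans (sym (+-suc a t)) e

opposite<ᵇ≡≤ᵇ : ∀ m (i : Fin (m + m)) → (toℕ (opposite i) <ᵇ m) ≡ (m ≤ᵇ toℕ i)
opposite<ᵇ≡≤ᵇ m i = ⇔→≡ (begin
  (toℕ (opposite i) <ᵇ m) ≡ true ≈⟨ Reflects⇒≡true⇔ (<ᵇ-reflects-< _ m) ⟩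
  toℕ (opposite i) < m          ≈⟨ a+suc[t]≡m+m⇒a<m⇔m≤t opposite+suc≡ ⟩
  m ≤ toℕ i                     ≈⟨ Reflects⇒≡true⇔ (≤ᵇ-reflects-≤ m _) ⟨
  (m ≤ᵇ toℕ i) ≡ true           ∎)
  where
  open ⇔-Reasoning
  opposite+suc≡ : toℕ (opposite i) + suc (toℕ i) ≡ m + m
  opposite+suc≡ = trans (cong (_+ suc (toℕ i)) (opposite-prop i)) (m∸n+n≡m (toℕ<n i))

f₁∘opposite≡f₂ : ∀ m (a : Fin (m + m) → Bool) → f₁ m (a ∘ opposite) ≡ f₂ m a
f₁∘opposite≡f₂ m a = cong₂ _∨_
  (allFin-permute Perm.reverse λ i →
    cong₂ (λ c x → if c then x else true) (opposite<ᵇ≡≤ᵇ m i) (cong a (opposite-involutive i)))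
  (allFin-permute Perm.reverse λ i → cong (not ∘ a) (opposite-involutive i))

mainTheorem1 : (m : ℕ) → HasSwitchListWithAtMost 2 (f₁ m) × HasSwitchListWithAtMost 2 (f₂ m)
mainTheorem1 m =
  (Perm.reverse , length-switches≤2 (f₁ m) Perm.reverse λ b 1+b< →
     fNum-f₂-switch m b 1+b< ∘ subst₂ _≢_ (f₁∘opposite≡f₂ m _) (f₁∘opposite≡f₂ m _)) ,
  (Perm.id , length-switches≤2 (f₂ m) Perm.id (fNum-f₂-switch m))
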